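{- Consider an instance of \textsc{RAI} with machines $\mathcal{M}=\{0,\dots,m-1\}$ in their natural order, job $j$ eligible exactly on $\mathcal{M}(j)=\{\ell(j),\dots,r(j)\}$, and let $T>0$ and $\xi=\frac1{24}$. Call a job small if $p_j\le 0.5T$, large if $0.5T<p_j\le(0.5+\xi)T$, and huge if $p_j>(0.5+\xi)T$; let $\mathcal{S},\mathcal{L},\mathcal{H}$ be the sets of small, large and huge jobs. For $\ell\le r$ let $\mathcal{M}(\ell,r)=\{\ell,\dots,r\}$, $\mathcal{S}(\ell,r)=\{j\in\mathcal{S}:\mathcal{M}(j)\subseteq\mathcal{M}(\ell,r)\}$ and $UB(\ell,r)=\big\lfloor (T|\mathcal{M}(\ell,r)|-\sum_{j\in\mathcal{S}(\ell,r)}p_j)/((0.5+\xi)T)\big\rfloor$. Let $x=(x_{ij})_{i\in\mathcal{M},j\in\mathcal{J}}$ with $x_{ij}\in[0,1]$ satisfy: $\sum_{i\in\mathcal{M}}x_{ij}=1$ for all $j$; $\sum_{j}p_jx_{ij}\le T$ for all $i$; $x_{ij}=0$ whenever $i\notin\mathcal{M}(j)$; $\sum_{j\in\mathcal{L}\cup\mathcal{H}}x_{ij}\le 1$ for all $i$; and $\sum_{i\in\mathcal{M}(\ell,r)}\sum_{j\in\mathcal{H}}x_{ij}\le UB(\ell,r)$ for all $\ell\le r$. Place the huge jobs as follows: for $i^*=0,1,\dots,m-1$ in order, let $H$ be the set of huge jobs not yet placed that are eligible on $i^*$; if $\big\lfloor\sum_{i=0}^{i^*}\sum_{j\in\mathcal{H}}x_{ij}\big\rfloor>\big\lfloor\sum_{i=0}^{i^*-1}\sum_{j\in\mathcal{H}}x_{ij}\big\rfloor$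 and $H\neq\emptyset$, place on $i^*$ a job $j\in H$ with minimal $r(j)$ (setting $\bar x_{i^*j}=1$; all other $\bar x_{ij}$ for huge $j$ are $0$). Then every huge job is placed by this procedure on an eligible machine, and for all $\ell\le r$ we have $\sum_{i\in\mathcal{M}(\ell,r)}\sum_{j\in\mathcal{H}}\bar x_{ij}\le\big\lceil\sum_{i\in\mathcal{M}(\ell,r)}\sum_{j\in\mathcal{H}}x_{ij}\big\rceil$.
   Context: \textsc{RAI}: restricted assignment with interval restrictions, i.e., jobs with sizes $p_j$ and machines in a total order, each job eligible on a set of consecutive machines. An empty sum (e.g. $\sum_{i=0}^{ -1}$) equals $0$. -}

module Defs where

open import Level using (Level; _⊔_) renaming (suc to lsuc)
open import Algebra.Bundles using (CommutativeRing)
open import Data.Nat as ℕ using (ℕ; zero; suc; _∸_)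
open import Data.Integer as ℤ using (ℤ; +_; -[1+_])
open import Data.Fin as Fin using (Fin; toℕ)
open import Data.Fin.Properties using () renaming (_≟_ to _≟ᶠ_)
open import Data.Bool using (if_then_else_)
open import Data.Maybe using (Maybe; just; nothing)
open import Data.Product using (Σ; ∃; _×_; _,_)
open import Data.Sum using (_⊎_)
open import Function using (_∘_)
open import Relation.Nullary using (¬_; Dec; does; _×-dec_; ¬?)
open import Relation.Binary using (Rel; IsTotalOrder)
open import Relation.Binary.PropositionalEquality using (_≡_; _≢_)
open import Relation.Unary using (Pred) renaming (Decidable to DecidableP)
open import Relation.Binary using () renaming (Decidable to DecidableR)

module Embed {c ℓ} (R : CommutativeRing c ℓ) where
  open CommutativeRing R
  fromℕ : ℕ → Carrier
  fromℕ zero = 0#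
  fromℕ (suc n) = 1# + fromℕ n
  fromℤ : ℤ → Carrier
  fromℤ (+ n) = fromℕ n
  fromℤ -[1+ n ] = - fromℕ (suc n)

-- A (classical) totally ordered field with a floor function.
-- The real numbers ℝ are a model; the statement is proved for every
-- such field (agda-stdlib has no reals).

record FloorField c ℓ : Set (lsuc (c ⊔ ℓ)) where
  field
    commRing : CommutativeRing c ℓ
  open CommutativeRing commRing public
  open Embed commRing public
  infix 4 _≤_ _<_
  field
    _≤_          : Rel Carrier ℓ
    isTotalOrder : IsTotalOrder _≈_ _≤_
    _≤?_         : DecidableR _≤_
    +-monoˡ-≤    : ∀ {x y} z → x ≤ y → x + z ≤ y + z
    *-nonneg     : ∀ {x y} → 0# ≤ x → 0# ≤ y → 0# ≤ x * y
    0≉1          : ¬ (0# ≈ 1#)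
    _⁻¹          : Carrier → Carrier
    ⁻¹-inverse   : ∀ x → ¬ (x ≈ 0#) → x * (x ⁻¹) ≈ 1#
    ⌊_⌋          : Carrier → ℤ
    floor-≤      : ∀ x → fromℤ ⌊ x ⌋ ≤ x
    floor-<      : ∀ x → ¬ (fromℤ ⌊ x ⌋ + 1# ≤ x)

  _<_ : Rel Carrier ℓ
  x < y = ¬ (y ≤ x)

  ⌈_⌉ : Carrier → ℤ
  ⌈ x ⌉ = ℤ.- ⌊ - x ⌋

module RAI {c ℓ} (F : FloorField c ℓ) where
  open FloorField F

  sum : (n : ℕ) → (Fin n → Carrier) → Carrier
  sum zero    f = 0#
  sum (suc n) f = f Fin.zero + sum n (f ∘ Fin.suc)

  sumIf : ∀ {n a} {P : Pred (Fin n) a} → DecidableP P → (Fin n → Carrier) → Carrier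
  sumIf {n} P? f = sum n (λ i → if does (P? i) then f i else 0#)

  half : Carrier
  half = (1# + 1#) ⁻¹

  ξ : Carrier
  ξ = (fromℕ 24) ⁻¹

  -- m machines (Fin m), n jobs (Fin n); job j is eligible exactly on
  -- the machines lo j, …, hi j;  p j is the size of job j.
  module Instance (m n : ℕ) (lo hi : Fin n → Fin m)
                  (p : Fin n → Carrier) (T : Carrier) where

    Small : Pred (Fin n) ℓ
    Small j = p j ≤ half * T

    small? : DecidableP Small
    small? j = p j ≤? (half * T)

    LargeOrHuge : Pred (Fin n) ℓ
    LargeOrHuge j = (half * T) < p j

    largeOrHuge? : DecidableP LargeOrHuge
    largeOrHuge? j = ¬? (p j ≤? (half * T))

    Huge : Pred (Fin n) ℓ
    Huge j = ((half + ξ) * T) < p j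

    huge? : DecidableP Huge
    huge? j = ¬? (p j ≤? ((half + ξ) * T))

    InM : Fin m → Fin m → Pred (Fin m) _
    InM l r i = l Fin.≤ i × i Fin.≤ r

    inM? : ∀ l r → DecidableP (InM l r)
    inM? l r i = (l Fin.≤? i) ×-dec (i Fin.≤? r)

    Eligible : Fin m → Fin n → Set
    Eligible i j = InM (lo j) (hi j) i

    -- j ∈ S(l, r):  j small and M(j) ⊆ M(l, r)  (intervals: l ≤ lo j, hi j ≤ r)
    SmallIn : Fin m → Fin m → Pred (Fin n) ℓ
    SmallIn l r j = Small j × (l Fin.≤ lo j × hi j Fin.≤ r)

    smallIn? : ∀ l r → DecidableP (SmallIn l r)
    smallIn? l r j = small? j ×-dec ((l Fin.≤? lo j) ×-dec (hi j Fin.≤? r))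

    -- |M(l, r)| = r - l + 1
    UB : Fin m → Fin m → ℤ
    UB l r = ⌊ (T * fromℕ (suc (toℕ r ∸ toℕ l)) - sumIf (smallIn? l r) p)
               * (((half + ξ) * T) ⁻¹) ⌋

    hugeMass : (Fin m → Fin n → Carrier) → Fin m → Carrier
    hugeMass y i = sumIf huge? (y i)

    hugeIn : (Fin m → Fin n → Carrier) → Fin m → Fin m → Carrier
    hugeIn y l r = sumIf (inM? l r) (hugeMass y)

    record FeasibleLP (x : Fin m → Fin n → Carrier) : Set (c ⊔ ℓ) where
      field
        x-range  : ∀ i j → (0# ≤ x i j) × (x i j ≤ 1#)
        assigned : ∀ j → sum m (λ i → x i j) ≈ 1#
        load     : ∀ i → sum n (λ j → p j * x i j) ≤ T
        inelig   : ∀ i j → ¬ Eligible i j → x i j ≈ 0#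
        lh-cap   : ∀ i → sumIf largeOrHuge? (x i) ≤ 1#
        ub-cap   : ∀ l r → l Fin.≤ r → hugeIn x l r ≤ fromℤ (UB l r)

    -- Σ_{i < k} Σ_{j ∈ H} x i j   (so prefix x (suc i*) = Σ_{i=0}^{i*}, prefix x i* = Σ_{i=0}^{i*-1})
    prefix : (Fin m → Fin n → Carrier) → ℕ → Carrier
    prefix x k = sumIf (λ i → toℕ i ℕ.<? k) (hugeMass x)

    -- A run of the placement procedure is recorded as σ : Fin m → Maybe (Fin n),
    -- σ i* = just j meaning job j is placed on machine i* at step i*.
    module Run (x : Fin m → Fin n → Carrier) (σ : Fin m → Maybe (Fin n)) where

      Unplaced : Fin m → Fin n → Set
      Unplaced i* j = ∀ i → i Fin.< i* → σ i ≢ just j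

      Cand : Fin m → Fin n → Set ℓ
      Cand i* j = Huge j × Unplaced i* j × Eligible i* j

      Trigger : Fin m → Set
      Trigger i* = ⌊ prefix x (toℕ i*) ⌋ ℤ.< ⌊ prefix x (suc (toℕ i*)) ⌋

      Step : Fin m → Set ℓ
      Step i* =
          (Trigger i* × (∃ λ j → Cand i* j) ×
             (∃ λ j → σ i* ≡ just j × Cand i* j × (∀ j′ → Cand i* j′ → hi j Fin.≤ hi j′)))
        ⊎ (¬ (Trigger i* × (∃ λ j → Cand i* j)) × σ i* ≡ nothing)

    IsRun : (Fin m → Fin n → Carrier) → (Fin m → Maybe (Fin n)) → Set ℓ
    IsRun x σ = ∀ i* → Run.Step x σ i*

    xbar : (Fin m → Maybe (Fin n)) → Fin m → Fin n → Carrier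
    xbar σ i j with σ i
    ... | nothing = 0#
    ... | just k  = if does (k ≟ᶠ j) then 1# else 0#

  Lemma3 : Set (c ⊔ ℓ)
  Lemma3 =
    (m n : ℕ) (lo hi : Fin n → Fin m) → (∀ j → lo j Fin.≤ hi j) →
    (p : Fin n → Carrier) → (∀ j → 0# ≤ p j) →
    (T : Carrier) → 0# < T →
    let open Instance m n lo hi p T in
    (x : Fin m → Fin n → Carrier) → FeasibleLP x →
    (σ : Fin m → Maybe (Fin n)) → IsRun x σ →
      (∀ j → Huge j → ∃ λ i → σ i ≡ just j × Eligible i j)
    × (∀ l r → l Fin.≤ r → hugeIn (xbar σ) l r ≤ fromℤ ⌈ hugeIn x l r ⌉)

-- Let h i be the huge mass of x on machine i and G t the floor of the prefix mass
-- Σ_{i<t} h i. Since 0 ≤ h i ≤ 1, G grows by 0 or 1 at each machine, and the procedure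
-- fires exactly where it grows. Along the run two counting inequalities persist for the
-- huge jobs still waiting after step k: those with r(j) < d need at least as many
-- increments of G in [k, d) (each carries a whole unit of LP mass there, by the choice of
-- minimal r(j)), and the increments of G in [k, t] are matched by waiting jobs with
-- ℓ(j) ≤ t. The second makes every firing step find a candidate, so x̄ places exactly
-- G(r+1) − G(ℓ) huge jobs on M(ℓ, r), an integer less than Σ_{M(ℓ,r)} h + 1; the first with
-- d = m leaves no huge job unplaced. Besides x ≥ 0, only the assignment, eligibility and
-- large/huge capacity constraints of the LP are used.

module Submission where

open import Defs
open import Level using (Level; 0ℓ)
open import Data.Nat as ℕ using (ℕ; zero; suc; z≤n; s≤s)
import Data.Nat.Properties as ℕ
open import Data.Integer as ℤ using (+_; -[1+_])
import Data.Integer.Properties as ℤ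
open import Data.Fin as Fin using (Fin; toℕ)
import Data.Fin.Properties as Fin
open import Data.Bool using (if_then_else_)
open import Data.Product using (∃; _×_; _,_; proj₁; proj₂)
open import Data.Empty using (⊥-elim)
open import Data.Sum using (_⊎_; inj₁; inj₂; [_,_]′)
open import Function using (_∘_)
open import Data.Maybe using (Maybe; just; nothing)
import Data.Maybe.Properties as Maybe
open import Relation.Nullary using (¬_; Dec; does; yes; no; contradiction; _×-dec_; ¬?; _→-dec_)
open import Relation.Binary using (IsTotalOrder; Poset)
open import Relation.Binary.PropositionalEquality as ≡ using (_≡_; _≢_)
open import Relation.Unary using (Pred; _⊆_; _∩_) renaming (Decidable to DecidableP)
open import Relation.Unary.Properties using (_∩?_; U?)

module FloorFieldProperties {c ℓ} (F : FloorField c ℓ) where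
  open FloorField F
  open IsTotalOrder isTotalOrder using (isPartialOrder; total)
  open IsTotalOrder isTotalOrder public using (antisym)
    renaming (reflexive to ≤-reflexive; trans to ≤-trans)
  open import Algebra.Properties.Ring ring
    using (-‿involutive; -0#≈0#; -‿+-comm; +-cancelʳ; -‿distribʳ-*; -1*x≈-x)
  open import Algebra.Solver.CommutativeMonoid +-commutativeMonoid
    using (solve; _⊕_; _⊜_)

  poset : Poset c ℓ ℓ
  poset = record { isPartialOrder = isPartialOrder }

  open import Relation.Binary.Reasoning.PartialOrder poset public

  ≮⇒≥ : ∀ {x y} → ¬ (x < y) → y ≤ x
  ≮⇒≥ {x} {y} x≮y with y ≤? x
  ... | yes y≤x = y≤x
  ... | no  y≰x = contradiction y≰x x≮y

  <⇒≤ : ∀ {x y} → x < y → x ≤ y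
  <⇒≤ {x} {y} x<y with total x y
  ... | inj₁ x≤y = x≤y
  ... | inj₂ y≤x = contradiction y≤x x<y

  <-≤-trans : ∀ {x y z} → x < y → y ≤ z → x < z
  <-≤-trans x<y y≤z z≤x = x<y (≤-trans y≤z z≤x)

  ≤-<-trans : ∀ {x y z} → x ≤ y → y < z → x < z
  ≤-<-trans x≤y y<z z≤x = y<z (≤-trans z≤x x≤y)

  +-monoʳ-≤ : ∀ {x y} z → x ≤ y → z + x ≤ z + y
  +-monoʳ-≤ {x} {y} z x≤y = begin
    z + x  ≈⟨ +-comm z x ⟩
    x + z  ≤⟨ +-monoˡ-≤ z x≤y ⟩
    y + z  ≈⟨ +-comm y z ⟩
    z + y  ∎

  +-mono-≤ : ∀ {x y u v} → x ≤ y → u ≤ v → x + u ≤ y + v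
  +-mono-≤ {y = y} {u} x≤y u≤v = ≤-trans (+-monoˡ-≤ u x≤y) (+-monoʳ-≤ y u≤v)

  x≤x+y : ∀ x {y} → 0# ≤ y → x ≤ x + y
  x≤x+y x {y} 0≤y = begin
    x       ≈⟨ +-identityʳ x ⟨
    x + 0#  ≤⟨ +-monoʳ-≤ x 0≤y ⟩
    x + y   ∎

  x+y-y≈x : ∀ x y → (x + y) - y ≈ x
  x+y-y≈x x y = begin-equality
    (x + y) - y    ≈⟨ +-assoc x y (- y) ⟩
    x + (y - y)    ≈⟨ +-congˡ (-‿inverseʳ y) ⟩
    x + 0#         ≈⟨ +-identityʳ x ⟩
    x              ∎

  +-cancelʳ-≤ : ∀ {x y} z → x + z ≤ y + z → x ≤ y
  +-cancelʳ-≤ {x} {y} z x+z≤y+z = begin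
    x              ≈⟨ x+y-y≈x x z ⟨
    (x + z) - z    ≤⟨ +-monoˡ-≤ (- z) x+z≤y+z ⟩
    (y + z) - z    ≈⟨ x+y-y≈x y z ⟩
    y              ∎

  +-monoˡ-< : ∀ {x y} z → x < y → x + z < y + z
  +-monoˡ-< z x<y y+z≤x+z = x<y (+-cancelʳ-≤ z y+z≤x+z)

  +-monoʳ-< : ∀ {x y} z → x < y → z + x < z + y
  +-monoʳ-< {x} {y} z x<y z+y≤z+x = +-monoˡ-< z x<y (begin
    y + z  ≈⟨ +-comm y z ⟩
    z + y  ≤⟨ z+y≤z+x ⟩
    z + x  ≈⟨ +-comm z x ⟩
    x + z  ∎)

  +-cancelʳ-< : ∀ {x y} z → x + z < y + z → x < y
  +-cancelʳ-< z x+z<y+z y≤x = x+z<y+z (+-monoˡ-≤ z y≤x)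

  x+y≤y⇒x≤0 : ∀ {x y} → x + y ≤ y → x ≤ 0#
  x+y≤y⇒x≤0 {y = y} x+y≤y = +-cancelʳ-≤ y (≤-trans x+y≤y (≤-reflexive (sym (+-identityˡ y))))

  x+[y+1]≈[x+1]+y : ∀ x y → x + (y + 1#) ≈ (x + 1#) + y
  x+[y+1]≈[x+1]+y x y = solve 3 (λ x y o → (x ⊕ (y ⊕ o)) ⊜ ((x ⊕ o) ⊕ y)) refl x y 1#

  -‿antitone : ∀ {x y} → x ≤ y → - y ≤ - x
  -‿antitone {x} {y} x≤y = begin
    - y              ≈⟨ +-identityˡ (- y) ⟨
    0# - y           ≈⟨ +-congʳ (-‿inverseʳ x) ⟨
    (x - x) - y      ≈⟨ solve 3 (λ a b c → ((a ⊕ b) ⊕ c) ⊜ (a ⊕ (c ⊕ b))) refl x (- x) (- y) ⟩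
    x + (- y - x)    ≤⟨ +-monoˡ-≤ (- y - x) x≤y ⟩
    y + (- y - x)    ≈⟨ solve 3 (λ a b c → (a ⊕ (b ⊕ c)) ⊜ ((a ⊕ b) ⊕ c)) refl y (- y) (- x) ⟩
    (y - y) - x      ≈⟨ +-congʳ (-‿inverseʳ y) ⟩
    0# - x           ≈⟨ +-identityˡ (- x) ⟩
    - x              ∎

  0<1 : 0# < 1#
  0<1 1≤0 = 0≉1 (antisym 0≤1 1≤0)
    where
    0≤-1 : 0# ≤ - 1#
    0≤-1 = begin
      0#       ≈⟨ -‿inverseʳ 1# ⟨
      1# - 1#  ≤⟨ +-monoˡ-≤ (- 1#) 1≤0 ⟩
      0# - 1#  ≈⟨ +-identityˡ (- 1#) ⟩
      - 1#     ∎
    0≤1 : 0# ≤ 1#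
    0≤1 = begin
      0#          ≤⟨ *-nonneg 0≤-1 0≤-1 ⟩
      - 1# * - 1# ≈⟨ -1*x≈-x (- 1#) ⟩
      - (- 1#)    ≈⟨ -‿involutive 1# ⟩
      1#          ∎

  0≤1 : 0# ≤ 1#
  0≤1 = <⇒≤ 0<1

  ⁻¹-nonneg : ∀ {y} → 0# < y → 0# ≤ y ⁻¹
  ⁻¹-nonneg {y} 0<y = ≮⇒≥ y⁻¹≮0
    where
    y⁻¹≮0 : ¬ (y ⁻¹ < 0#)
    y⁻¹≮0 y⁻¹<0 = 0<1 (begin
      1#                 ≈⟨ +-identityˡ 1# ⟨
      0# + 1#            ≤⟨ +-monoˡ-≤ 1# (*-nonneg (<⇒≤ 0<y) 0≤-y⁻¹) ⟩
      y * - (y ⁻¹) + 1#  ≈⟨ +-congʳ (-‿distribʳ-* y (y ⁻¹)) ⟨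
      - (y * y ⁻¹) + 1#  ≈⟨ +-congʳ (-‿cong (⁻¹-inverse y y≉0)) ⟩
      - 1# + 1#          ≈⟨ -‿inverseˡ 1# ⟩
      0#                 ∎)
      where
      0≤-y⁻¹ : 0# ≤ - (y ⁻¹)
      0≤-y⁻¹ = ≤-trans (≤-reflexive (sym -0#≈0#)) (-‿antitone (<⇒≤ y⁻¹<0))
      y≉0 : ¬ (y ≈ 0#)
      y≉0 y≈0 = 0<y (≤-reflexive y≈0)

  fromℕ-+ : ∀ a b → fromℕ (a ℕ.+ b) ≈ fromℕ a + fromℕ b
  fromℕ-+ zero    b = sym (+-identityˡ (fromℕ b))
  fromℕ-+ (suc a) b = trans (+-congˡ (fromℕ-+ a b)) (sym (+-assoc 1# (fromℕ a) (fromℕ b)))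

  fromℕ-nonneg : ∀ a → 0# ≤ fromℕ a
  fromℕ-nonneg zero    = ≤-reflexive refl
  fromℕ-nonneg (suc a) = begin
    0#             ≤⟨ 0≤1 ⟩
    1#             ≤⟨ x≤x+y 1# (fromℕ-nonneg a) ⟩
    1# + fromℕ a   ∎

  fromℕ-mono : ∀ {a b} → a ℕ.≤ b → fromℕ a ≤ fromℕ b
  fromℕ-mono {b = b} z≤n = fromℕ-nonneg b
  fromℕ-mono (s≤s a≤b)   = +-monoʳ-≤ 1# (fromℕ-mono a≤b)

  fromℕ-suc-pos : ∀ a → 0# < fromℕ (suc a)
  fromℕ-suc-pos a = <-≤-trans 0<1 (x≤x+y 1# (fromℕ-nonneg a))

  Integral : Carrier → Set ℓ
  Integral y = ∃ λ a → ∃ λ b → y + fromℕ b ≈ fromℕ a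

  integral-resp : ∀ {x y} → x ≈ y → Integral x → Integral y
  integral-resp x≈y (a , b , x+b≈a) = a , b , trans (+-congʳ (sym x≈y)) x+b≈a

  integral-fromℕ : ∀ a → Integral (fromℕ a)
  integral-fromℕ a = a , 0 , +-identityʳ (fromℕ a)

  integral-+ : ∀ {x y} → Integral x → Integral y → Integral (x + y)
  integral-+ {x} {y} (a , b , x+b≈a) (a′ , b′ , y+b′≈a′) = a ℕ.+ a′ , b ℕ.+ b′ , (begin-equality
    (x + y) + fromℕ (b ℕ.+ b′)      ≈⟨ +-congˡ (fromℕ-+ b b′) ⟩
    (x + y) + (fromℕ b + fromℕ b′)  ≈⟨ solve 4 (λ a b c d → ((a ⊕ b) ⊕ (c ⊕ d)) ⊜ ((a ⊕ c) ⊕ (b ⊕ d)))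
                                         refl x y (fromℕ b) (fromℕ b′) ⟩
    (x + fromℕ b) + (y + fromℕ b′)  ≈⟨ +-cong x+b≈a y+b′≈a′ ⟩
    fromℕ a + fromℕ a′              ≈⟨ fromℕ-+ a a′ ⟨
    fromℕ (a ℕ.+ a′)                ∎)

  integral-neg : ∀ {x} → Integral x → Integral (- x)
  integral-neg {x} (a , b , x+b≈a) = b , a , (begin-equality
    - x + fromℕ a              ≈⟨ +-congˡ x+b≈a ⟨
    - x + (x + fromℕ b)        ≈⟨ +-assoc (- x) x (fromℕ b) ⟨
    (- x + x) + fromℕ b        ≈⟨ +-congʳ (-‿inverseˡ x) ⟩
    0# + fromℕ b               ≈⟨ +-identityˡ (fromℕ b) ⟩
    fromℕ b                    ∎)

  integral-fromℤ : ∀ z → Integral (fromℤ z)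
  integral-fromℤ (+ a)    = integral-fromℕ a
  integral-fromℤ -[1+ a ] = integral-neg (integral-fromℕ (suc a))

  integral-<1⇒≤0 : ∀ {y} → Integral y → y < 1# → y ≤ 0#
  integral-<1⇒≤0 {y} (a , b , y+b≈a) y<1 with a ℕ.≤? b
  ... | yes a≤b with ℕ.m≤n⇒∃[o]m+o≡n a≤b
  ...   | k , ≡.refl = begin
    y            ≤⟨ x≤x+y y (fromℕ-nonneg k) ⟩
    y + fromℕ k  ≈⟨ +-cancelʳ (fromℕ a) (y + fromℕ k) 0# (begin-equality
      (y + fromℕ k) + fromℕ a    ≈⟨ solve 3 (λ y k a → ((y ⊕ k) ⊕ a) ⊜ (y ⊕ (a ⊕ k)))
                                      refl y (fromℕ k) (fromℕ a) ⟩
      y + (fromℕ a + fromℕ k)    ≈⟨ +-congˡ (fromℕ-+ a k) ⟨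
      y + fromℕ (a ℕ.+ k)        ≈⟨ y+b≈a ⟩
      fromℕ a                    ≈⟨ +-identityˡ (fromℕ a) ⟨
      0# + fromℕ a               ∎) ⟩
    0#           ∎
  integral-<1⇒≤0 {y} (a , b , y+b≈a) y<1 | no a≰b with ℕ.m≤n⇒∃[o]m+o≡n (ℕ.≰⇒> a≰b)
  ... | k , ≡.refl = contradiction (begin
    1#             ≤⟨ x≤x+y 1# (fromℕ-nonneg k) ⟩
    1# + fromℕ k   ≈⟨ +-cancelʳ (fromℕ b) (1# + fromℕ k) y (begin-equality
      (1# + fromℕ k) + fromℕ b   ≈⟨ solve 3 (λ o k b → ((o ⊕ k) ⊕ b) ⊜ (o ⊕ (b ⊕ k)))
                                      refl 1# (fromℕ k) (fromℕ b) ⟩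
      1# + (fromℕ b + fromℕ k)   ≈⟨ +-congˡ (fromℕ-+ b k) ⟨
      fromℕ (suc b ℕ.+ k)        ≈⟨ y+b≈a ⟨
      y + fromℕ b                ∎) ⟩
    y              ∎) y<1

  integral-<+1⇒≤ : ∀ {x y} → Integral x → Integral y → x < y + 1# → x ≤ y
  integral-<+1⇒≤ {x} {y} ix iy x<y+1 = begin
    x              ≈⟨ x+y-y≈x x (- y) ⟨
    (x - y) - - y  ≤⟨ +-monoˡ-≤ (- - y) x-y≤0 ⟩
    0# - - y       ≈⟨ +-identityˡ (- - y) ⟩
    - - y          ≈⟨ -‿involutive y ⟩
    y              ∎
    where
    x-y<1 : x - y < 1#
    x-y<1 = <-≤-trans (+-monoˡ-< (- y) x<y+1) (≤-reflexive (begin-equality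
      (y + 1#) - y  ≈⟨ +-congʳ (+-comm y 1#) ⟩
      (1# + y) - y  ≈⟨ x+y-y≈x 1# y ⟩
      1#            ∎))
    x-y≤0 : x - y ≤ 0#
    x-y≤0 = integral-<1⇒≤0 (integral-+ ix (integral-neg iy)) x-y<1

  integral-1 : Integral 1#
  integral-1 = integral-resp (+-identityʳ 1#) (integral-fromℕ 1)

  -fromℕ≤0 : ∀ a → - fromℕ a ≤ 0#
  -fromℕ≤0 a = ≤-trans (-‿antitone (fromℕ-nonneg a)) (≤-reflexive -0#≈0#)

  fromℤ-mono : ∀ {z w} → z ℤ.≤ w → fromℤ z ≤ fromℤ w
  fromℤ-mono (ℤ.-≤- n≤m)     = -‿antitone (fromℕ-mono (s≤s n≤m))
  fromℤ-mono (ℤ.-≤+ {m} {n}) = ≤-trans (-fromℕ≤0 (suc m)) (fromℕ-nonneg n)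
  fromℤ-mono (ℤ.+≤+ m≤n)     = fromℕ-mono m≤n

  -[1+a]+1≈-a : ∀ a → fromℤ -[1+ a ] + 1# ≈ - fromℕ a
  -[1+a]+1≈-a a = begin-equality
    - (1# + fromℕ a) + 1#    ≈⟨ +-congʳ (-‿+-comm 1# (fromℕ a)) ⟨
    (- 1# - fromℕ a) + 1#    ≈⟨ solve 3 (λ u v w → ((u ⊕ v) ⊕ w) ⊜ (v ⊕ (u ⊕ w)))
                                    refl (- 1#) (- fromℕ a) 1# ⟩
    - fromℕ a + (- 1# + 1#)  ≈⟨ +-congˡ (-‿inverseˡ 1#) ⟩
    - fromℕ a + 0#           ≈⟨ +-identityʳ (- fromℕ a) ⟩
    - fromℕ a                ∎

  fromℤ-<⇒+1≤ : ∀ {z w} → z ℤ.< w → fromℤ z + 1# ≤ fromℤ w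
  fromℤ-<⇒+1≤ (ℤ.-<- {m} n<m) = ≤-trans (≤-reflexive (-[1+a]+1≈-a m)) (-‿antitone (fromℕ-mono n<m))
  fromℤ-<⇒+1≤ (ℤ.-<+ {m} {n}) =
    ≤-trans (≤-reflexive (-[1+a]+1≈-a m)) (≤-trans (-fromℕ≤0 m) (fromℕ-nonneg n))
  fromℤ-<⇒+1≤ (ℤ.+<+ {m} m<n) = ≤-trans (≤-reflexive (+-comm (fromℕ m) 1#)) (fromℕ-mono m<n)

  fromℤ-neg : ∀ z → fromℤ (ℤ.- z) ≈ - fromℤ z
  fromℤ-neg (+ zero)  = sym -0#≈0#
  fromℤ-neg (+ suc a) = refl
  fromℤ-neg -[1+ a ]  = sym (-‿involutive (fromℕ (suc a)))

  floor-greatest : ∀ {x y} → Integral x → x ≤ y → x ≤ fromℤ ⌊ y ⌋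
  floor-greatest {y = y} ix x≤y = integral-<+1⇒≤ ix (integral-fromℤ ⌊ y ⌋) (≤-<-trans x≤y (floor-< y))

  floor-mono : ∀ {x y} → x ≤ y → fromℤ ⌊ x ⌋ ≤ fromℤ ⌊ y ⌋
  floor-mono {x} x≤y = floor-greatest (integral-fromℤ ⌊ x ⌋) (≤-trans (floor-≤ x) x≤y)

  floor-≤+1 : ∀ {x y} → y ≤ x + 1# → fromℤ ⌊ y ⌋ ≤ fromℤ ⌊ x ⌋ + 1#
  floor-≤+1 {x} {y} y≤x+1 =
    integral-<+1⇒≤ (integral-fromℤ ⌊ y ⌋) (integral-+ (integral-fromℤ ⌊ x ⌋) integral-1)
      (≤-<-trans (≤-trans (floor-≤ y) y≤x+1) (+-monoˡ-< 1# (floor-< x)))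

  floor-step-< : ∀ {x y} → y ≤ x + 1# → ⌊ x ⌋ ℤ.< ⌊ y ⌋ → fromℤ ⌊ y ⌋ ≈ fromℤ ⌊ x ⌋ + 1#
  floor-step-< y≤x+1 ⌊x⌋<⌊y⌋ = antisym (floor-≤+1 y≤x+1) (fromℤ-<⇒+1≤ ⌊x⌋<⌊y⌋)

  floor-step-≮ : ∀ {x y} → x ≤ y → ¬ (⌊ x ⌋ ℤ.< ⌊ y ⌋) → fromℤ ⌊ y ⌋ ≈ fromℤ ⌊ x ⌋
  floor-step-≮ x≤y ⌊x⌋≮⌊y⌋ = antisym (fromℤ-mono (ℤ.≮⇒≥ ⌊x⌋≮⌊y⌋)) (floor-mono x≤y)

  ceil-≥ : ∀ y → y ≤ fromℤ ⌈ y ⌉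
  ceil-≥ y = begin
    y                ≈⟨ -‿involutive y ⟨
    - - y            ≤⟨ -‿antitone (floor-≤ (- y)) ⟩
    - fromℤ ⌊ - y ⌋  ≈⟨ fromℤ-neg ⌊ - y ⌋ ⟨
    fromℤ ⌈ y ⌉      ∎

  integral-<+1⇒≤⌈⌉ : ∀ {x y} → Integral x → x < y + 1# → x ≤ fromℤ ⌈ y ⌉
  integral-<+1⇒≤⌈⌉ {y = y} ix x<y+1 =
    integral-<+1⇒≤ ix (integral-fromℤ ⌈ y ⌉) (<-≤-trans x<y+1 (+-monoˡ-≤ 1# (ceil-≥ y)))

module FiniteSums {c ℓ} (F : FloorField c ℓ) where
  open FloorField F
  open RAI F using (sum; sumIf)
  open FloorFieldProperties F
  open import Algebra.Solver.CommutativeMonoid +-commutativeMonoid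
    using (solve; _⊕_; _⊜_)
  import Algebra.Properties.CommutativeMonoid.Sum +-commutativeMonoid as ∑

  sum≡∑ : ∀ k (f : Fin k → Carrier) → sum k f ≡ ∑.sum f
  sum≡∑ zero    f = ≡.refl
  sum≡∑ (suc k) f = ≡.cong (λ s → f Fin.zero + s) (sum≡∑ k (f ∘ Fin.suc))

  sum-cong : ∀ k {f g : Fin k → Carrier} → (∀ i → f i ≈ g i) → sum k f ≈ sum k g
  sum-cong zero    f≈g = refl
  sum-cong (suc k) f≈g = +-cong (f≈g Fin.zero) (sum-cong k (f≈g ∘ Fin.suc))

  sum-mono : ∀ k {f g : Fin k → Carrier} → (∀ i → f i ≤ g i) → sum k f ≤ sum k g
  sum-mono zero    f≤g = ≤-reflexive refl
  sum-mono (suc k) f≤g = +-mono-≤ (f≤g Fin.zero) (sum-mono k (f≤g ∘ Fin.suc))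

  sum-zero : ∀ k {f : Fin k → Carrier} → (∀ i → f i ≈ 0#) → sum k f ≈ 0#
  sum-zero k {f} f≈0 = begin-equality
    sum k f               ≈⟨ sum-cong k f≈0 ⟩
    sum k (λ _ → 0#)      ≡⟨ sum≡∑ k (λ _ → 0#) ⟩
    ∑.sum {k} (λ _ → 0#)  ≈⟨ ∑.sum-replicate-zero k ⟩
    0#                    ∎

  sum-nonneg : ∀ k {f : Fin k → Carrier} → (∀ i → 0# ≤ f i) → 0# ≤ sum k f
  sum-nonneg k {f} 0≤f = begin
    0#                ≈⟨ sum-zero k {λ _ → 0#} (λ _ → refl) ⟨
    sum k (λ _ → 0#)  ≤⟨ sum-mono k 0≤f ⟩
    sum k f           ∎

  sum-+ : ∀ k (f g : Fin k → Carrier) → sum k (λ i → f i + g i) ≈ sum k f + sum k g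
  sum-+ k f g = begin-equality
    sum k (λ i → f i + g i)  ≡⟨ sum≡∑ k (λ i → f i + g i) ⟩
    ∑.sum (λ i → f i + g i)  ≈⟨ ∑.∑-distrib-+ f g ⟩
    ∑.sum f + ∑.sum g        ≡⟨ ≡.cong₂ _+_ (sum≡∑ k f) (sum≡∑ k g) ⟨
    sum k f + sum k g        ∎

  sum-comm : ∀ k l (f : Fin k → Fin l → Carrier) →
             sum k (λ i → sum l (f i)) ≈ sum l (λ j → sum k (λ i → f i j))
  sum-comm k l f = begin-equality
    sum k (λ i → sum l (f i))          ≡⟨ sum≡∑ k _ ⟩
    ∑.sum (λ i → sum l (f i))          ≡⟨ ∑.sum-cong-≗ (λ i → sum≡∑ l (f i)) ⟩
    ∑.sum (λ i → ∑.sum (f i))          ≈⟨ ∑.∑-comm f ⟩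
    ∑.sum (λ j → ∑.sum (λ i → f i j))  ≡⟨ ∑.sum-cong-≗ (λ j → sum≡∑ k (λ i → f i j)) ⟨
    ∑.sum (λ j → sum k (λ i → f i j))  ≡⟨ sum≡∑ l _ ⟨
    sum l (λ j → sum k (λ i → f i j))  ∎

  -- sumIf P? f unfolds to sum k (λ i → f i when P? i).
  infixl 7 _when_
  _when_ : ∀ {a} {A : Set a} → Carrier → Dec A → Carrier
  x when a? = if does a? then x else 0#

  module _ {a} {A : Set a} where

    when-no : ∀ {x} (a? : Dec A) → ¬ A → x when a? ≈ 0#
    when-no (yes a) ¬a = contradiction a ¬a
    when-no (no _)  _  = refl

    when-nonneg : ∀ {x} (a? : Dec A) → 0# ≤ x → 0# ≤ x when a?
    when-nonneg (yes _) 0≤x = 0≤x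
    when-nonneg (no _)  _   = ≤-reflexive refl

    sum-when : ∀ k (f : Fin k → Carrier) (a? : Dec A) →
               sum k f when a? ≈ sum k (λ i → f i when a?)
    sum-when k f (yes _) = refl
    sum-when k f (no _)  = sym (sum-zero k (λ _ → refl))

  when-comm : ∀ {a b} {A : Set a} {B : Set b} x (a? : Dec A) (b? : Dec B) →
              x when a? when b? ≈ x when b? when a?
  when-comm x (yes _) (yes _) = refl
  when-comm x (yes _) (no _)  = refl
  when-comm x (no _)  (yes _) = refl
  when-comm x (no _)  (no _)  = refl

  sum-when-≡ : ∀ k (i₀ : Fin k) (f : Fin k → Carrier) → sum k (λ i → f i when (i₀ Fin.≟ i)) ≈ f i₀
  sum-when-≡ (suc k) Fin.zero     f = trans (+-congˡ (sum-zero k (λ _ → refl))) (+-identityʳ _)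
  sum-when-≡ (suc k) (Fin.suc i₀) f = trans (+-identityˡ _) (sum-when-≡ k i₀ (f ∘ Fin.suc))

  module _ {k a b} {P : Pred (Fin k) a} {Q : Pred (Fin k) b}
           (P? : DecidableP P) (Q? : DecidableP Q) where

    sumIf-⊆ : ∀ {f} → P ⊆ Q → (∀ i → Q i → ¬ P i → f i ≈ 0#) → sumIf P? f ≈ sumIf Q? f
    sumIf-⊆ {f} P⊆Q f≈0 = sum-cong k pointwise
      where
      pointwise : ∀ i → f i when P? i ≈ f i when Q? i
      pointwise i with P? i | Q? i
      ... | yes _  | yes _  = refl
      ... | yes p  | no ¬q  = contradiction (P⊆Q p) ¬q
      ... | no ¬p  | yes q  = sym (f≈0 i q ¬p)
      ... | no _   | no _   = refl

    sumIf-≐ : ∀ {f} → P ⊆ Q → Q ⊆ P → sumIf P? f ≈ sumIf Q? f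
    sumIf-≐ P⊆Q Q⊆P = sumIf-⊆ P⊆Q (λ _ q ¬p → contradiction (Q⊆P q) ¬p)

    sumIf-monoˡ : ∀ {f} → P ⊆ Q → (∀ i → 0# ≤ f i) → sumIf P? f ≤ sumIf Q? f
    sumIf-monoˡ {f} P⊆Q 0≤f = sum-mono k pointwise
      where
      pointwise : ∀ i → f i when P? i ≤ f i when Q? i
      pointwise i with P? i | Q? i
      ... | yes _  | yes _  = ≤-reflexive refl
      ... | yes p  | no ¬q  = contradiction (P⊆Q p) ¬q
      ... | no _   | yes _  = 0≤f i
      ... | no _   | no _   = ≤-reflexive refl

  module _ {k a} {P : Pred (Fin k) a} (P? : DecidableP P) where

    sumIf-cong : ∀ {f g} → (∀ i → P i → f i ≈ g i) → sumIf P? f ≈ sumIf P? g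
    sumIf-cong {f} {g} f≈g = sum-cong k pointwise
      where
      pointwise : ∀ i → f i when P? i ≈ g i when P? i
      pointwise i with P? i
      ... | yes p = f≈g i p
      ... | no _  = refl

    sumIf-mono : ∀ {f g} → (∀ i → P i → f i ≤ g i) → sumIf P? f ≤ sumIf P? g
    sumIf-mono {f} {g} f≤g = sum-mono k pointwise
      where
      pointwise : ∀ i → f i when P? i ≤ g i when P? i
      pointwise i with P? i
      ... | yes p = f≤g i p
      ... | no _  = ≤-reflexive refl

    sumIf-nonneg : ∀ {f} → (∀ i → 0# ≤ f i) → 0# ≤ sumIf P? f
    sumIf-nonneg 0≤f = sum-nonneg k (λ i → when-nonneg (P? i) (0≤f i))

    sumIf-full : ∀ {f} → (∀ i → ¬ P i → f i ≈ 0#) → sumIf P? f ≈ sum k f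
    sumIf-full f≈0 = sumIf-⊆ P? U? _ (λ i _ → f≈0 i)

    sumIf-≤-sum : ∀ {f} → (∀ i → 0# ≤ f i) → sumIf P? f ≤ sum k f
    sumIf-≤-sum 0≤f = sumIf-monoˡ P? U? _ 0≤f

    sumIf-vanish : ∀ {f} → (∀ i → P i → f i ≈ 0#) → sumIf P? f ≈ 0#
    sumIf-vanish {f} f≈0 = sum-zero k pointwise
      where
      pointwise : ∀ i → f i when P? i ≈ 0#
      pointwise i with P? i
      ... | yes p = f≈0 i p
      ... | no _  = refl

    sumIf-term : ∀ {f} → (∀ i → 0# ≤ f i) → ∀ {i} → P i → f i ≤ sumIf P? f
    sumIf-term {f} 0≤f {i} p = begin
      f i                 ≈⟨ sum-when-≡ k i f ⟨
      sumIf (i Fin.≟_) f  ≤⟨ sumIf-monoˡ (i Fin.≟_) P? (λ { ≡.refl → p }) 0≤f ⟩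
      sumIf P? f          ∎

  module _ {k a b r} {R : Pred (Fin k) r} {P : Pred (Fin k) a} {Q : Pred (Fin k) b}
           (R? : DecidableP R) (P? : DecidableP P) (Q? : DecidableP Q) where

    sumIf-split : ∀ {f} → (∀ {i} → R i → P i ⊎ Q i) → P ⊆ R → Q ⊆ R → (∀ {i} → P i → ¬ Q i) →
                  sumIf R? f ≈ sumIf P? f + sumIf Q? f
    sumIf-split {f} R⊆P∪Q P⊆R Q⊆R P∩Q=∅ = trans (sum-cong k pointwise) (sum-+ k _ _)
      where
      pointwise : ∀ i → f i when R? i ≈ f i when P? i + f i when Q? i
      pointwise i with R? i | P? i | Q? i
      ... | _     | yes p | yes q = contradiction q (P∩Q=∅ p)
      ... | yes _ | yes _ | no _  = sym (+-identityʳ (f i))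
      ... | yes _ | no _  | yes _ = sym (+-identityˡ (f i))
      ... | yes r | no ¬p | no ¬q = ⊥-elim ([ ¬p , ¬q ]′ (R⊆P∪Q r))
      ... | no ¬r | yes p | no _  = contradiction (P⊆R p) ¬r
      ... | no ¬r | no _  | yes q = contradiction (Q⊆R q) ¬r
      ... | no _  | no _  | no _  = sym (+-identityʳ 0#)

  module _ {k a b} {P : Pred (Fin k) a} {Q : Pred (Fin k) b}
           (P? : DecidableP P) (Q? : DecidableP Q) where

    sumIf-insert : ∀ {f} i₀ → Q ⊆ P → (∀ {i} → P i → i ≢ i₀ → Q i) → ¬ Q i₀ → P i₀ →
                   sumIf P? f ≈ sumIf Q? f + f i₀
    sumIf-insert {f} i₀ Q⊆P P-i₀⊆Q ¬q₀ p₀ = begin-equality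
      sumIf P? f                     ≈⟨ sumIf-split P? Q? (i₀ Fin.≟_) P⊆Q∪i₀ Q⊆P (λ { ≡.refl → p₀ })
                                          (λ { q ≡.refl → ¬q₀ q }) ⟩
      sumIf Q? f + sumIf (i₀ Fin.≟_) f ≈⟨ +-congˡ (sum-when-≡ k i₀ f) ⟩
      sumIf Q? f + f i₀              ∎
      where
      P⊆Q∪i₀ : ∀ {i} → P i → Q i ⊎ i₀ ≡ i
      P⊆Q∪i₀ {i} p with i₀ Fin.≟ i
      ... | yes i₀≡i = inj₂ i₀≡i
      ... | no i₀≢i  = inj₁ (P-i₀⊆Q p (i₀≢i ∘ ≡.sym))

  sumIf-comm : ∀ {k l a b} {I : Pred (Fin k) a} {J : Pred (Fin l) b}
               (I? : DecidableP I) (J? : DecidableP J) (f : Fin k → Fin l → Carrier) →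
               sumIf I? (λ i → sumIf J? (f i)) ≈ sumIf J? (λ j → sumIf I? (λ i → f i j))
  sumIf-comm {k} {l} I? J? f = begin-equality
    sum k (λ i → sum l (λ j → f i j when J? j) when I? i)  ≈⟨ sum-cong k (λ i → sum-when l _ (I? i)) ⟩
    sum k (λ i → sum l (λ j → f i j when J? j when I? i))  ≈⟨ sum-cong k (λ i → sum-cong l (λ j →
                                                                when-comm (f i j) (J? j) (I? i))) ⟩
    sum k (λ i → sum l (λ j → f i j when I? i when J? j))  ≈⟨ sum-comm k l _ ⟩
    sum l (λ j → sum k (λ i → f i j when I? i when J? j))  ≈⟨ sum-cong l (λ j → sum-when k _ (J? j)) ⟨
    sum l (λ j → sum k (λ i → f i j when I? i) when J? j)  ∎

  sum-integral : ∀ k {f : Fin k → Carrier} → (∀ i → Integral (f i)) → Integral (sum k f)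
  sum-integral zero    _    = integral-fromℕ 0
  sum-integral (suc k) intf = integral-+ (intf Fin.zero) (sum-integral k (intf ∘ Fin.suc))

  count : ∀ {k a} {P : Pred (Fin k) a} → DecidableP P → Carrier
  count P? = sumIf P? (λ _ → 1#)

  module _ {k a} {P : Pred (Fin k) a} (P? : DecidableP P) where

    count-integral : Integral (count P?)
    count-integral = sum-integral k integral-when
      where
      integral-when : ∀ i → Integral (1# when P? i)
      integral-when i with P? i
      ... | yes _ = integral-1
      ... | no _  = integral-fromℕ 0

    count-≥1 : ∀ {i} → P i → 1# ≤ count P?
    count-≥1 = sumIf-term P? (λ _ → 0≤1)

    count-≤0⇒∅ : count P? ≤ 0# → ∀ {i} → ¬ P i
    count-≤0⇒∅ count≤0 p = 0<1 (≤-trans (count-≥1 p) count≤0)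

    count-≥1⇒∃ : 1# ≤ count P? → ∃ P
    count-≥1⇒∃ 1≤count with Fin.any? P?
    ... | yes ∃p = ∃p
    ... | no ∄p  = contradiction (≤-trans 1≤count (≤-reflexive count≈0)) 0<1
      where
      count≈0 : count P? ≈ 0#
      count≈0 = sumIf-vanish P? (λ i p → contradiction (i , p) ∄p)

  prefixSum : ∀ {k} → ℕ → (Fin k → Carrier) → Carrier
  prefixSum t = sumIf (λ i → toℕ i ℕ.<? t)

  prefixSum-zero : ∀ k (f : Fin k → Carrier) → prefixSum 0 f ≈ 0#
  prefixSum-zero k f = sum-zero k (λ _ → refl)

  prefixSum-suc : ∀ k (f : Fin k → Carrier) i → prefixSum (suc (toℕ i)) f ≈ prefixSum (toℕ i) f + f i
  prefixSum-suc (suc k) f Fin.zero = begin-equality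
    f Fin.zero + prefixSum 0 (f ∘ Fin.suc)         ≈⟨ +-congˡ (prefixSum-zero k (f ∘ Fin.suc)) ⟩
    f Fin.zero + 0#                                ≈⟨ +-comm _ _ ⟩
    0# + f Fin.zero                                ≈⟨ +-congʳ (prefixSum-zero (suc k) f) ⟨
    prefixSum 0 f + f Fin.zero                     ∎
  prefixSum-suc (suc k) f (Fin.suc i) =
    trans (+-congˡ (prefixSum-suc k (f ∘ Fin.suc) i)) (sym (+-assoc (f Fin.zero) _ (f (Fin.suc i))))

  prefixSum-telescope : ∀ k (f : Fin k → Carrier) (g : ℕ → Carrier) →
                        (∀ i → f i + g (toℕ i) ≈ g (suc (toℕ i))) →
                        ∀ t → t ℕ.≤ k → prefixSum t f + g 0 ≈ g t
  prefixSum-telescope k       f g step zero    _         = trans (+-congʳ (prefixSum-zero k f)) (+-identityˡ (g 0))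
  prefixSum-telescope (suc k) f g step (suc t) (s≤s t≤k) = begin-equality
    (f Fin.zero + S) + g 0   ≈⟨ solve 3 (λ a b c → ((a ⊕ b) ⊕ c) ⊜ (b ⊕ (a ⊕ c))) refl (f Fin.zero) S (g 0) ⟩
    S + (f Fin.zero + g 0)   ≈⟨ +-congˡ (step Fin.zero) ⟩
    S + g 1                  ≈⟨ prefixSum-telescope k (f ∘ Fin.suc) (g ∘ suc) (step ∘ Fin.suc) t t≤k ⟩
    g (suc t)                ∎
    where
    S = prefixSum t (f ∘ Fin.suc)

  Between : ∀ {k} → ℕ → ℕ → Pred (Fin k) 0ℓ
  Between a b i = a ℕ.≤ toℕ i × toℕ i ℕ.< b

  between? : ∀ {k} a b → DecidableP (Between {k} a b)
  between? a b i = (a ℕ.≤? toℕ i) ×-dec (toℕ i ℕ.<? b)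

  sumBetween+prefixSum : ∀ {k} {a b} (f : Fin k → Carrier) → a ℕ.≤ b →
                         sumIf (between? a b) f + prefixSum a f ≈ prefixSum b f
  sumBetween+prefixSum {k} {a} {b} f a≤b =
    sym (sumIf-split (λ (i : Fin k) → toℕ i ℕ.<? b) (between? a b) (λ i → toℕ i ℕ.<? a) {f}
          below-b proj₂ (λ i<a → ℕ.<-≤-trans i<a a≤b) (λ (a≤i , _) i<a → ℕ.<⇒≱ i<a a≤i))
    where
    below-b : ∀ {i} → toℕ i ℕ.< b → Between a b i ⊎ toℕ i ℕ.< a
    below-b {i} i<b with a ℕ.≤? toℕ i
    ... | yes a≤i = inj₁ (a≤i , i<b)
    ... | no  a≰i = inj₂ (ℕ.≰⇒> a≰i)

module Placement {c ℓ} (F : FloorField c ℓ)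
                 (m n : ℕ) (lo hi : Fin n → Fin m) (p : Fin n → FloorField.Carrier F)
                 (T : FloorField.Carrier F) (0<T : FloorField._<_ F (FloorField.0# F) T)
                 (x : Fin m → Fin n → FloorField.Carrier F)
                 (feasible : RAI.Instance.FeasibleLP F m n lo hi p T x) where
  open FloorField F
  open RAI F
  open Instance m n lo hi p T
  open FeasibleLP feasible
  open FloorFieldProperties F
  open FiniteSums F

  x-nonneg : ∀ i j → 0# ≤ x i j
  x-nonneg i j = proj₁ (x-range i j)

  huge⊆largeOrHuge : Huge ⊆ LargeOrHuge
  huge⊆largeOrHuge = ≤-<-trans (begin
    half * T           ≤⟨ x≤x+y (half * T) (*-nonneg (⁻¹-nonneg (fromℕ-suc-pos 23)) (<⇒≤ 0<T)) ⟩
    half * T + ξ * T   ≈⟨ distribʳ T half ξ ⟨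
    (half + ξ) * T     ∎)

  h : Fin m → Carrier
  h = hugeMass x

  h-nonneg : ∀ i → 0# ≤ h i
  h-nonneg i = sumIf-nonneg huge? (x-nonneg i)

  h≤1 : ∀ i → h i ≤ 1#
  h≤1 i = ≤-trans (sumIf-monoˡ huge? largeOrHuge? huge⊆largeOrHuge (x-nonneg i)) (lh-cap i)

  P : ℕ → Carrier
  P = prefix x

  -- Trigger i says exactly that G jumps at i.
  G : ℕ → Carrier
  G t = fromℤ ⌊ P t ⌋

  P-suc : ∀ i → P (suc (toℕ i)) ≈ P (toℕ i) + h i
  P-suc = prefixSum-suc m h

  G-step-< : ∀ i → ⌊ P (toℕ i) ⌋ ℤ.< ⌊ P (suc (toℕ i)) ⌋ → G (suc (toℕ i)) ≈ G (toℕ i) + 1#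
  G-step-< i = floor-step-< (≤-trans (≤-reflexive (P-suc i)) (+-monoʳ-≤ _ (h≤1 i)))

  G-step-≮ : ∀ i → ¬ (⌊ P (toℕ i) ⌋ ℤ.< ⌊ P (suc (toℕ i)) ⌋) → G (suc (toℕ i)) ≈ G (toℕ i)
  G-step-≮ i = floor-step-≮ (≤-trans (x≤x+y _ (h-nonneg i)) (≤-reflexive (sym (P-suc i))))

  G-0-nonneg : 0# ≤ G 0
  G-0-nonneg = floor-greatest (integral-fromℕ 0) (≤-reflexive (sym (prefixSum-zero m h)))

  column-sum : ∀ {a} {I : Pred (Fin m) a} (I? : DecidableP I) j →
               (∀ {i} → Eligible i j → I i) → sumIf I? (λ i → x i j) ≈ 1#
  column-sum I? j eligible⊆I = trans (sumIf-full I? (λ i ¬Ii → inelig i j (¬Ii ∘ eligible⊆I))) (assigned j)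

  column-sum-≤1 : ∀ {a} {I : Pred (Fin m) a} (I? : DecidableP I) j → sumIf I? (λ i → x i j) ≤ 1#
  column-sum-≤1 I? j = ≤-trans (sumIf-≤-sum I? (λ i → x-nonneg i j)) (≤-reflexive (assigned j))

  column-sum-0 : ∀ {a} {I : Pred (Fin m) a} (I? : DecidableP I) j →
                 (∀ {i} → I i → ¬ Eligible i j) → sumIf I? (λ i → x i j) ≈ 0#
  column-sum-0 I? j I∩eligible=∅ = sumIf-vanish I? (λ i Ii → inelig i j (I∩eligible=∅ Ii))

  count-≤-sumBetween : ∀ {s} {S : Pred (Fin n) s} (S? : DecidableP S) {a b} → S ⊆ Huge →
                       (∀ {j} → S j → ∀ {i} → Eligible i j → Between a b i) →
                       count S? ≤ sumIf (between? a b) h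
  count-≤-sumBetween S? {a} {b} S⊆Huge S-inside = begin
    count S?
      ≈⟨ sumIf-cong S? (λ j Sj → sym (column-sum (between? a b) j (S-inside Sj))) ⟩
    sumIf S? (λ j → sumIf (between? a b) (λ i → x i j))
      ≈⟨ sumIf-comm (between? a b) S? x ⟨
    sumIf (between? a b) (λ i → sumIf S? (x i))
      ≤⟨ sumIf-mono (between? a b) (λ i _ → sumIf-monoˡ S? huge? S⊆Huge (x-nonneg i)) ⟩
    sumIf (between? a b) h
      ∎

  count+G≤G : ∀ {s} {S : Pred (Fin n) s} (S? : DecidableP S) {a b} → a ℕ.≤ b → S ⊆ Huge →
              (∀ {j} → S j → ∀ {i} → Eligible i j → Between a b i) →
              count S? + G a ≤ G b
  count+G≤G S? {a} {b} a≤b S⊆Huge S-inside =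
    floor-greatest (integral-+ (count-integral S?) (integral-fromℤ ⌊ P a ⌋)) (begin
      count S? + G a                   ≤⟨ +-monoʳ-≤ (count S?) (floor-≤ (P a)) ⟩
      count S? + P a                   ≤⟨ +-monoˡ-≤ (P a) (count-≤-sumBetween S? S⊆Huge S-inside) ⟩
      sumIf (between? a b) h + P a     ≈⟨ sumBetween+prefixSum h a≤b ⟩
      P b                              ∎)

  hi<? : ∀ d j → Dec (toℕ (hi j) ℕ.< d)
  hi<? d j = toℕ (hi j) ℕ.<? d

  lo≤? : ∀ t j → Dec (toℕ (lo j) ℕ.≤ t)
  lo≤? t j = toℕ (lo j) ℕ.≤? t

  P-suc-≤-count : ∀ t → P (suc t) ≤ count (huge? ∩? lo≤? t)
  P-suc-≤-count t = begin
    sumIf below (λ i → sumIf huge? (x i))              ≈⟨ sumIf-comm below huge? x ⟩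
    sumIf huge? (λ j → sumIf below (λ i → x i j))      ≈⟨ sumIf-⊆ released? huge? proj₁ unreleased-vanish ⟨
    sumIf released? (λ j → sumIf below (λ i → x i j))  ≤⟨ sumIf-mono released? (λ j _ → column-sum-≤1 below j) ⟩
    count released?                                    ∎
    where
    below : ∀ i → Dec (toℕ i ℕ.< suc t)
    below i = toℕ i ℕ.<? suc t
    released? = huge? ∩? lo≤? t
    unreleased-vanish : ∀ j → Huge j → ¬ (Huge j × toℕ (lo j) ℕ.≤ t) → sumIf below (λ i → x i j) ≈ 0#
    unreleased-vanish j huge ¬released = column-sum-0 below j
      (λ i<1+t (lo≤i , _) → ¬released (huge , ℕ.≤-trans lo≤i (ℕ.s≤s⁻¹ i<1+t)))

  hugeIn+prefixSum : ∀ y l r → l Fin.≤ r →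
                     hugeIn y l r + prefixSum (toℕ l) (hugeMass y) ≈ prefixSum (suc (toℕ r)) (hugeMass y)
  hugeIn+prefixSum y l r l≤r = begin-equality
    hugeIn y l r + prefixSum (toℕ l) (hugeMass y)
      ≈⟨ +-congʳ (sumIf-≐ (inM? l r) (between? (toℕ l) (suc (toℕ r)))
                   (λ (l≤i , i≤r) → l≤i , s≤s i≤r) (λ (l≤i , i<1+r) → l≤i , ℕ.s≤s⁻¹ i<1+r)) ⟩
    sumIf (between? (toℕ l) (suc (toℕ r))) (hugeMass y) + prefixSum (toℕ l) (hugeMass y)
      ≈⟨ sumBetween+prefixSum (hugeMass y) (ℕ.m≤n⇒m≤1+n l≤r) ⟩
    prefixSum (suc (toℕ r)) (hugeMass y)
      ∎

  module Schedule (σ : Fin m → Maybe (Fin n)) (run : IsRun x σ) where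
    open Run x σ

    NotPlacedBefore : ℕ → Pred (Fin n) 0ℓ
    NotPlacedBefore k j = ∀ i → toℕ i ℕ.< k → σ i ≢ just j

    notPlacedBefore? : ∀ k → DecidableP (NotPlacedBefore k)
    notPlacedBefore? k j = Fin.all? λ i → (toℕ i ℕ.<? k) →-dec ¬? (Maybe.≡-dec Fin._≟_ (σ i) (just j))

    Waiting : ℕ → Pred (Fin n) ℓ
    Waiting k = Huge ∩ NotPlacedBefore k

    waiting? : ∀ k → DecidableP (Waiting k)
    waiting? k = huge? ∩? notPlacedBefore? k

    dueBefore : ℕ → ℕ → Carrier
    dueBefore k d = count (waiting? k ∩? hi<? d)

    releasedBy : ℕ → ℕ → Carrier
    releasedBy k t = count (waiting? k ∩? lo≤? t)

    record Invariant (k : ℕ) : Set ℓ where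
      field
        due      : ∀ d → k ℕ.≤ d → dueBefore k d + G k ≤ G d
        released : ∀ t → k ℕ.≤ t → G (suc t) ≤ releasedBy k t + G k

    open Invariant

    waiting⇒≤hi : ∀ {k j} → Invariant k → Waiting k j → k ℕ.≤ toℕ (hi j)
    waiting⇒≤hi {k} inv w = ℕ.≮⇒≥ λ hi<k →
      count-≤0⇒∅ (waiting? k ∩? hi<? k) (x+y≤y⇒x≤0 (due inv k ℕ.≤-refl)) (w , hi<k)

    waiting-restrict : ∀ {k j} → Waiting (suc k) j → Waiting k j
    waiting-restrict (huge , notPlaced) = huge , λ i i<k → notPlaced i (ℕ.m<n⇒m<1+n i<k)

    notPlacedBefore-extend : ∀ {i j} → σ i ≢ just j →
                             NotPlacedBefore (toℕ i) j → NotPlacedBefore (suc (toℕ i)) j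
    notPlacedBefore-extend {i} σi≢j notPlaced i′ i′<1+i with ℕ.m<1+n⇒m<n∨m≡n i′<1+i
    ... | inj₁ i′<i = notPlaced i′ i′<i
    ... | inj₂ i′≡i rewrite Fin.toℕ-injective i′≡i = σi≢j

    module _ {q} {Q : Pred (Fin n) q} (Q? : DecidableP Q) (i : Fin m) where

      count-waiting-idle : σ i ≡ nothing →
                           count (waiting? (suc (toℕ i)) ∩? Q?) ≈ count (waiting? (toℕ i) ∩? Q?)
      count-waiting-idle σi≡nothing = sumIf-≐ (waiting? (suc (toℕ i)) ∩? Q?) (waiting? (toℕ i) ∩? Q?)
        (λ (w , Qj) → waiting-restrict w , Qj)
        (λ ((huge , notPlaced) , Qj) → (huge , notPlacedBefore-extend σi≢j notPlaced) , Qj)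
        where
        σi≢j : ∀ {j} → σ i ≢ just j
        σi≢j σi≡j with ≡.trans (≡.sym σi≡nothing) σi≡j
        ... | ()

      count-waiting-place : ∀ {j₀} → σ i ≡ just j₀ → Waiting (toℕ i) j₀ → Q j₀ →
                            count (waiting? (toℕ i) ∩? Q?) ≈ count (waiting? (suc (toℕ i)) ∩? Q?) + 1#
      count-waiting-place {j₀} σi≡j₀ w₀ Qj₀ =
        sumIf-insert (waiting? (toℕ i) ∩? Q?) (waiting? (suc (toℕ i)) ∩? Q?) j₀
          (λ (w , Qj) → waiting-restrict w , Qj)
          (λ ((huge , notPlaced) , Qj) j≢j₀ → (huge , notPlacedBefore-extend (σi≢j j≢j₀) notPlaced) , Qj)
          (λ ((_ , notPlaced) , _) → notPlaced i (ℕ.n<1+n (toℕ i)) σi≡j₀)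
          (w₀ , Qj₀)
        where
        σi≢j : ∀ {j} → j ≢ j₀ → σ i ≢ just j
        σi≢j j≢j₀ σi≡j = j≢j₀ (Maybe.just-injective (≡.trans (≡.sym σi≡j) σi≡j₀))

    data Outcome (i : Fin m) : Set ℓ where
      placed : Trigger i → ∀ j → σ i ≡ just j → Cand i j →
               (∀ j′ → Cand i j′ → hi j Fin.≤ hi j′) → Outcome i
      idle   : ¬ Trigger i → σ i ≡ nothing → Outcome i

    trigger⇒candidate : ∀ {i} → Invariant (toℕ i) → Trigger i → ∃ (Cand i)
    trigger⇒candidate {i} inv trigger with count-≥1⇒∃ (waiting? (toℕ i) ∩? lo≤? (toℕ i)) 1≤released
      where
      1≤released : 1# ≤ releasedBy (toℕ i) (toℕ i)
      1≤released = +-cancelʳ-≤ (G (toℕ i)) (begin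
        1# + G (toℕ i)                       ≈⟨ +-comm 1# (G (toℕ i)) ⟩
        G (toℕ i) + 1#                       ≈⟨ G-step-< i trigger ⟨
        G (suc (toℕ i))                      ≤⟨ released inv (toℕ i) ℕ.≤-refl ⟩
        releasedBy (toℕ i) (toℕ i) + G (toℕ i) ∎)
    ... | j , ((huge , notPlaced) , lo≤i) = j , huge , notPlaced , lo≤i , waiting⇒≤hi inv (huge , notPlaced)

    outcome : ∀ {i} → Invariant (toℕ i) → Outcome i
    outcome {i} inv with run i
    ... | inj₁ (trigger , _ , j , σi≡j , cand , minimal) = placed trigger j σi≡j cand minimal
    ... | inj₂ (¬[trigger×cand] , σi≡nothing) =
      idle (λ trigger → ¬[trigger×cand] (trigger , trigger⇒candidate inv trigger)) σi≡nothing

    invariant-zero : Invariant 0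
    invariant-zero .due d _ = count+G≤G (waiting? 0 ∩? hi<? d) z≤n (proj₁ ∘ proj₁)
      λ (_ , hi<d) (_ , i≤hi) → z≤n , ℕ.≤-<-trans i≤hi hi<d
    invariant-zero .released t _ = begin
      G (suc t)                                 ≤⟨ floor-≤ (P (suc t)) ⟩
      P (suc t)                                 ≤⟨ P-suc-≤-count t ⟩
      count (huge? ∩? lo≤? t)                   ≈⟨ sumIf-≐ (huge? ∩? lo≤? t) (waiting? 0 ∩? lo≤? t)
                                                     (λ (huge , lo≤t) → (huge , λ _ ()) , lo≤t)
                                                     (λ ((huge , _) , lo≤t) → huge , lo≤t) ⟩
      releasedBy 0 t                            ≤⟨ x≤x+y (releasedBy 0 t) G-0-nonneg ⟩
      releasedBy 0 t + G 0                      ∎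

    invariant-idle : ∀ {i} → Invariant (toℕ i) → ¬ Trigger i → σ i ≡ nothing → Invariant (suc (toℕ i))
    invariant-idle {i} inv ¬trigger σi≡nothing = record
      { due = λ d 1+i≤d → begin
          dueBefore (suc (toℕ i)) d + G (suc (toℕ i))  ≈⟨ +-cong (count-waiting-idle (hi<? d) i σi≡nothing)
                                                                  (G-step-≮ i ¬trigger) ⟩
          dueBefore (toℕ i) d + G (toℕ i)              ≤⟨ due inv d (ℕ.<⇒≤ 1+i≤d) ⟩
          G d                                          ∎
      ; released = λ t 1+i≤t → begin
          G (suc t)                                    ≤⟨ released inv t (ℕ.<⇒≤ 1+i≤t) ⟩
          releasedBy (toℕ i) t + G (toℕ i)             ≈⟨ +-cong (count-waiting-idle (lo≤? t) i σi≡nothing)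
                                                                  (G-step-≮ i ¬trigger) ⟨
          releasedBy (suc (toℕ i)) t + G (suc (toℕ i)) ∎
      }

    invariant-place : ∀ {i} → Invariant (toℕ i) → Trigger i → ∀ j₀ → σ i ≡ just j₀ → Cand i j₀ →
                      (∀ j → Cand i j → hi j₀ Fin.≤ hi j) → Invariant (suc (toℕ i))
    invariant-place {i} inv trigger j₀ σi≡j₀ (huge₀ , notPlaced₀ , lo₀≤i , _) minimal = record
      { due = due′
      ; released = λ t 1+i≤t → begin
          G (suc t)                                           ≤⟨ released inv t (ℕ.<⇒≤ 1+i≤t) ⟩
          releasedBy (toℕ i) t + G (toℕ i)                    ≈⟨ +-congʳ (count-waiting-place (lo≤? t) i σi≡j₀ waiting₀
                                                                   (ℕ.≤-trans lo₀≤i (ℕ.<⇒≤ 1+i≤t))) ⟩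
          (releasedBy (suc (toℕ i)) t + 1#) + G (toℕ i)       ≈⟨ x+[y+1]≈[x+1]+y _ _ ⟨
          releasedBy (suc (toℕ i)) t + (G (toℕ i) + 1#)       ≈⟨ +-congˡ (G-step-< i trigger) ⟨
          releasedBy (suc (toℕ i)) t + G (suc (toℕ i))        ∎
      }
      where
      waiting₀ : Waiting (toℕ i) j₀
      waiting₀ = huge₀ , notPlaced₀

      due′ : ∀ d → suc (toℕ i) ℕ.≤ d → dueBefore (suc (toℕ i)) d + G (suc (toℕ i)) ≤ G d
      due′ d 1+i≤d with hi<? d j₀
      ... | yes hi₀<d = begin
        dueBefore (suc (toℕ i)) d + G (suc (toℕ i))     ≈⟨ +-congˡ (G-step-< i trigger) ⟩
        dueBefore (suc (toℕ i)) d + (G (toℕ i) + 1#)    ≈⟨ x+[y+1]≈[x+1]+y _ _ ⟩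
        (dueBefore (suc (toℕ i)) d + 1#) + G (toℕ i)    ≈⟨ +-congʳ (count-waiting-place (hi<? d) i σi≡j₀
                                                                       waiting₀ hi₀<d) ⟨
        dueBefore (toℕ i) d + G (toℕ i)                 ≤⟨ due inv d (ℕ.<⇒≤ 1+i≤d) ⟩
        G d                                             ∎
      ... | no hi₀≮d = count+G≤G (waiting? (suc (toℕ i)) ∩? hi<? d) 1+i≤d (proj₁ ∘ proj₁)
        λ (w , hi<d) (lo≤i′ , i′≤hi) → ℕ.≤-trans (after-i w hi<d) lo≤i′ , ℕ.≤-<-trans i′≤hi hi<d
        where
        -- a waiting job released by step i would have been a candidate ending before j₀
        after-i : ∀ {j} → Waiting (suc (toℕ i)) j → toℕ (hi j) ℕ.< d → toℕ i ℕ.< toℕ (lo j)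
        after-i {j} w hi<d with waiting-restrict w
        ... | w′@(huge , notPlaced) = ℕ.≰⇒> λ lo≤i →
          hi₀≮d (ℕ.≤-<-trans (minimal j (huge , notPlaced , lo≤i , waiting⇒≤hi inv w′)) hi<d)

    invariant-suc : ∀ i → Invariant (toℕ i) → Invariant (suc (toℕ i))
    invariant-suc i inv with outcome inv
    ... | placed trigger j σi≡j cand minimal = invariant-place inv trigger j σi≡j cand minimal
    ... | idle ¬trigger σi≡nothing            = invariant-idle inv ¬trigger σi≡nothing

    invariant : ∀ k → k ℕ.≤ m → Invariant k
    invariant zero    _   = invariant-zero
    invariant (suc k) k<m =
      ≡.subst (Invariant ∘ suc) toℕ-i≡k (invariant-suc i (≡.subst Invariant (≡.sym toℕ-i≡k) inv))
      where
      i = Fin.fromℕ< k<m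
      toℕ-i≡k = Fin.toℕ-fromℕ< k<m
      inv = invariant k (ℕ.<⇒≤ k<m)

    outcome-at : ∀ i → Outcome i
    outcome-at i = outcome (invariant (toℕ i) (ℕ.<⇒≤ (Fin.toℕ<n i)))

    placed⇒eligible : ∀ {i j} → σ i ≡ just j → Eligible i j
    placed⇒eligible {i} σi≡j with outcome-at i
    ... | placed _ j′ σi≡j′ (_ , _ , eligible) _ with Maybe.just-injective (≡.trans (≡.sym σi≡j′) σi≡j)
    ...   | ≡.refl = eligible
    placed⇒eligible {i} σi≡j | idle _ σi≡nothing with ≡.trans (≡.sym σi≡nothing) σi≡j
    ...   | ()

    huge⇒placed : ∀ {j} → Huge j → ∃ λ i → σ i ≡ just j
    huge⇒placed {j} huge with Fin.any? (λ i → Maybe.≡-dec Fin._≟_ (σ i) (just j))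
    ... | yes σi≡j = σi≡j
    ... | no ¬placed = contradiction ((huge , λ i _ σi≡j → ¬placed (i , σi≡j)) , Fin.toℕ<n (hi j))
        (count-≤0⇒∅ (waiting? m ∩? hi<? m) (x+y≤y⇒x≤0 (due (invariant m ℕ.≤-refl) m ℕ.≤-refl)))

    every-huge-job-placed : ∀ j → Huge j → ∃ λ i → σ i ≡ just j × Eligible i j
    every-huge-job-placed j huge = let i , σi≡j = huge⇒placed huge in i , σi≡j , placed⇒eligible σi≡j

    xbar-placed : ∀ {i j₀} → σ i ≡ just j₀ → ∀ j → xbar σ i j ≡ 1# when (j₀ Fin.≟ j)
    xbar-placed σi≡j₀ j rewrite σi≡j₀ = ≡.refl

    xbar-idle : ∀ {i} → σ i ≡ nothing → ∀ j → xbar σ i j ≡ 0#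
    xbar-idle σi≡nothing j rewrite σi≡nothing = ≡.refl

    hugeMass-xbar : ∀ i → hugeMass (xbar σ) i + G (toℕ i) ≈ G (suc (toℕ i))
    hugeMass-xbar i with outcome-at i
    ... | placed trigger j₀ σi≡j₀ (huge₀ , _) _ = begin-equality
      hugeMass (xbar σ) i + G (toℕ i)
        ≈⟨ +-congʳ (sumIf-cong huge? (λ j _ → reflexive (xbar-placed σi≡j₀ j))) ⟩
      sumIf huge? (λ j → 1# when (j₀ Fin.≟ j)) + G (toℕ i)
        ≈⟨ +-congʳ (sumIf-full huge? (λ j ¬huge → when-no (j₀ Fin.≟ j) (λ { ≡.refl → ¬huge huge₀ }))) ⟩
      sum n (λ j → 1# when (j₀ Fin.≟ j)) + G (toℕ i)
        ≈⟨ +-congʳ (sum-when-≡ n j₀ (λ _ → 1#)) ⟩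
      1# + G (toℕ i)
        ≈⟨ +-comm 1# (G (toℕ i)) ⟩
      G (toℕ i) + 1#
        ≈⟨ G-step-< i trigger ⟨
      G (suc (toℕ i))
        ∎
    ... | idle ¬trigger σi≡nothing = begin-equality
      hugeMass (xbar σ) i + G (toℕ i)
        ≈⟨ +-congʳ (sumIf-vanish huge? (λ j _ → reflexive (xbar-idle σi≡nothing j))) ⟩
      0# + G (toℕ i)
        ≈⟨ +-identityˡ (G (toℕ i)) ⟩
      G (toℕ i)
        ≈⟨ G-step-≮ i ¬trigger ⟨
      G (suc (toℕ i))
        ∎

    hugeIn-xbar : ∀ l r → l Fin.≤ r → hugeIn (xbar σ) l r + G (toℕ l) ≈ G (suc (toℕ r))
    hugeIn-xbar l r l≤r = begin-equality
      X + G (toℕ l)                     ≈⟨ +-congˡ (telescope (toℕ l) (ℕ.<⇒≤ (Fin.toℕ<n l))) ⟨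
      X + (Q (toℕ l) + G 0)             ≈⟨ +-assoc X (Q (toℕ l)) (G 0) ⟨
      (X + Q (toℕ l)) + G 0             ≈⟨ +-congʳ (hugeIn+prefixSum (xbar σ) l r l≤r) ⟩
      Q (suc (toℕ r)) + G 0             ≈⟨ telescope (suc (toℕ r)) (Fin.toℕ<n r) ⟩
      G (suc (toℕ r))                   ∎
      where
      X = hugeIn (xbar σ) l r
      Q : ℕ → Carrier
      Q t = prefixSum t (hugeMass (xbar σ))
      telescope : ∀ t → t ℕ.≤ m → Q t + G 0 ≈ G t
      telescope = prefixSum-telescope m (hugeMass (xbar σ)) G hugeMass-xbar

    hugeIn-xbar≤⌈hugeIn-x⌉ : ∀ l r → l Fin.≤ r → hugeIn (xbar σ) l r ≤ fromℤ ⌈ hugeIn x l r ⌉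
    hugeIn-xbar≤⌈hugeIn-x⌉ l r l≤r = integral-<+1⇒≤⌈⌉ integral-X (+-cancelʳ-< (G (toℕ l)) X+G<D+1+G)
      where
      X = hugeIn (xbar σ) l r
      D = hugeIn x l r
      integral-X : Integral X
      integral-X = integral-resp (trans (+-congʳ (sym (hugeIn-xbar l r l≤r))) (x+y-y≈x X (G (toℕ l))))
        (integral-+ (integral-fromℤ ⌊ P (suc (toℕ r)) ⌋) (integral-neg (integral-fromℤ ⌊ P (toℕ l) ⌋)))
      X+G<D+1+G : X + G (toℕ l) < (D + 1#) + G (toℕ l)
      X+G<D+1+G = ≤-<-trans (begin
          X + G (toℕ l)           ≈⟨ hugeIn-xbar l r l≤r ⟩
          G (suc (toℕ r))         ≤⟨ floor-≤ (P (suc (toℕ r))) ⟩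
          P (suc (toℕ r))         ≈⟨ hugeIn+prefixSum x l r l≤r ⟨
          D + P (toℕ l)           ∎)
        (<-≤-trans (+-monoʳ-< D (floor-< (P (toℕ l)))) (≤-reflexive (x+[y+1]≈[x+1]+y D (G (toℕ l)))))

lemma3 : ∀ {c ℓ : Level} (F : FloorField c ℓ) → RAI.Lemma3 F
lemma3 F m n lo hi _ p _ T 0<T x feasible σ run = every-huge-job-placed , hugeIn-xbar≤⌈hugeIn-x⌉
  where open Placement.Schedule F m n lo hi p T 0<T x feasible σ run
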